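{- Let $P$ be a (possibly disjunctive) answer set program, let $\mathcal{CV}'=\{x'\mid x\in\mathrm{LA}(P)\}$ and $\mathcal{CV}^*=\{x^*\mid x\in\mathrm{LA}(P)\}$ be sets of fresh copy variables, and let $$\phi_2 = \mathrm{Comp}(P) \wedge \mathrm{Copy}'(P) \wedge \mathrm{Copy}^*(P) \wedge \bigwedge_{x \in \mathrm{LA}(P)} (x' \rightarrow x^*) \wedge \bigvee_{x \in \mathrm{LA}(P)} (\neg x' \wedge x^*).$$ Then the number of interpretations $M\subseteq\mathrm{at}(P)$ whose assignment $\tau_M$ is a model of $\mathrm{Comp}(P)$ but which are not answer sets of $P$ equals $\#\exists\, \mathcal{CV}'\cup\mathcal{CV}^*\ \phi_2$.
   Context: A program $P$ is a finite set of rules $r$ of the form $a_1 \vee \dots \vee a_k \leftarrow b_1, \dots, b_m, \mathsf{not}\ c_1, \dots, \mathsf{not}\ c_n$ ($k,m,n \ge 0$) over propositional atoms; $\mathrm{head}(r)=\{a_1,\dots,a_k\}$, $\mathrm{body}(r)^+=\{b_1,\dots,b_m\}$, $\mathrm{body}(r)^-=\{c_1,\dots,c_n\}$, and $\mathrm{body}(r)$ is the set of literals $\{b_1,\dots,b_m,\neg c_1,\dots,\neg c_n\}$. $\mathrm{at}(P)$ is the set of atoms of $P$. An interpretation is $M \subseteq \mathrm{at}(P)$, identified with the assignment $\tau_M$ on $\mathrm{at}(P)$ with $\tau_M(x)=1$ iff $x\in M$. $M \models r$ iff $(\mathrm{head}(r)\cup\mathrm{body}(r)^-)\cap M \neq\emptyset$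 or $\mathrm{body}(r)^+\setminus M\neq\emptyset$; $M\models P$ iff $M \models r$ for all rules. The reduct is $P^M=\{\mathrm{head}(r)\leftarrow \mathrm{body}(r)^+ \mid r\in P,\ \mathrm{body}(r)^-\cap M=\emptyset\}$. $M$ is an answer set iff $M\models P$ and there is no $M'\subsetneq M$ with $M'\models P^M$. The Clark completion $\mathrm{Comp}(P)$ is the propositional formula over $\mathrm{at}(P)$ that is the conjunction of: (1) $\neg a$ for each atom $a$ occurring in no rule head; (2) for each rule $r$, $\bigwedge_{\ell\in\mathrm{body}(r)}\ell \rightarrow \bigvee_{x\in\mathrm{head}(r)} x$; (3) for each atom $a$ occurring in some head, with $r_1,\dots,r_k$ all rules having $a$ in the head, $a \rightarrow \bigvee_{i=1}^k\big(\bigwedge_{\ell\in\mathrm{body}(r_i)}\ell \wedge \bigwedge_{x\in\mathrm{head}(r_i)\setminus\{a\}}\neg x\big)$. The positive dependency graph of $P$ has vertex set $\mathrm{at}(P)$ and an edge from $y$ to $x$ whenever some rule $r$ has $x\in\mathrm{body}(r)^+$ and $y\in\mathrm{head}(r)$. A set $L\subseteq \mathrm{at}(P)$ is a loop if for all $x,y\in L$ there is a non-empty directed path from $x$ to $y$ all of whose vertices lie in $L$; $\mathrm{LA}(P)$ (loop atoms) is the set of atoms belonging to some loop. For a set of fresh variables $\{\hat x \mid x\in\mathrm{LA}(P)\}$ (not in $\mathrm{at}(P)$), the copy operation produces the conjunction of: (type 1) $\hat x\rightarrow x$ for every $x\in\mathrm{LA}(P)$; (type 2) for each rule $r=a_1\vee\dots\vee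 a_k\leftarrow b_1,\dots,b_m,\mathsf{not}\ c_1,\dots,\mathsf{not}\ c_n$ with $\mathrm{head}(r)\cap\mathrm{LA}(P)\neq\emptyset$, the implication $f(b_1)\wedge\dots\wedge f(b_m)\wedge\neg c_1\wedge\dots\wedge\neg c_n\rightarrow f(a_1)\vee\dots\vee f(a_k)$, where $f(x)=\hat x$ if $x\in\mathrm{LA}(P)$ and $f(x)=x$ otherwise. $\mathrm{Copy}'(P)$ and $\mathrm{Copy}^*(P)$ are this construction using copy variables $x'$ and $x^*$ respectively. For a propositional formula $\phi$ and a set $X$ of its variables, $\#\exists X\,\phi$ is the number of assignments to the variables of $\phi$ outside $X$ that extend to a model of $\phi$. -}

module Defs where

open import Data.Nat using (ℕ)
open import Data.Fin using (Fin)
open import Data.Bool using (Bool; true; false)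
open import Data.Bool.Properties using () renaming (_≟_ to _≟ᵇ_)
open import Data.Vec using (Vec; lookup)
open import Data.List using (List; []; _++_; filter; map; length)
open import Data.List.Relation.Unary.All using (All; all?)
open import Data.List.Relation.Unary.Any using (Any)
open import Data.List.Membership.Propositional using (_∈_)
open import Data.List.Relation.Unary.Unique.Propositional using (Unique)
open import Data.Product using (Σ; ∃; ∃-syntax; _×_; _,_)
open import Data.Sum using (_⊎_)
open import Relation.Nullary using (¬_)
open import Relation.Binary.PropositionalEquality using (_≡_; _≢_)
open import Function.Bundles using (_⇔_)

-- Atoms of a program over n atoms are the elements of Fin n (at(P) = Fin n).
record Rule (n : ℕ) : Set where
  constructor _⇐_∣_
  field
    head : List (Fin n)
    pos  : List (Fin n)
    neg  : List (Fin n)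
open Rule public

Program : ℕ → Set
Program n = List (Rule n)

-- Interpretations M ⊆ at(P), as characteristic vectors; τ_M = lookup M.
Interp : ℕ → Set
Interp n = Vec Bool n

_∈ᴹ_ : ∀ {n} → Fin n → Interp n → Set
x ∈ᴹ M = lookup M x ≡ true

_∉ᴹ_ : ∀ {n} → Fin n → Interp n → Set
x ∉ᴹ M = lookup M x ≡ false

_⊨r_ : ∀ {n} → Interp n → Rule n → Set
M ⊨r r = Any (_∈ᴹ M) (head r ++ neg r) ⊎ Any (_∉ᴹ M) (pos r)

_⊨_ : ∀ {n} → Interp n → Program n → Set
M ⊨ P = All (M ⊨r_) P

reduct : ∀ {n} → Program n → Interp n → Program n
reduct P M =
  map (λ r → head r ⇐ pos r ∣ [])
      (filter (λ r → all? (λ c → lookup M c ≟ᵇ false) (neg r)) P)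

_⊊_ : ∀ {n} → Interp n → Interp n → Set
M' ⊊ M = (∀ x → x ∈ᴹ M' → x ∈ᴹ M) × (∃[ x ] (x ∈ᴹ M × x ∉ᴹ M'))

AnswerSet : ∀ {n} → Program n → Interp n → Set
AnswerSet P M = M ⊨ P × ¬ (∃[ M' ] (M' ⊊ M × M' ⊨ reduct P M))

-- Clark completion: satisfaction of Comp(P) by an assignment τ on at(P)

Assignment : ℕ → Set
Assignment n = Fin n → Bool

BodyHolds : ∀ {n} → Assignment n → Rule n → Set
BodyHolds τ r = All (λ b → τ b ≡ true) (pos r) × All (λ c → τ c ≡ false) (neg r)

InSomeHead : ∀ {n} → Program n → Fin n → Set
InSomeHead P a = ∃[ r ] (r ∈ P × a ∈ head r)

CompSat : ∀ {n} → Program n → Assignment n → Set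
CompSat P τ =
    (∀ a → ¬ InSomeHead P a → τ a ≡ false)
  × (∀ r → r ∈ P → BodyHolds τ r → Any (λ x → τ x ≡ true) (head r))
  × (∀ a → InSomeHead P a → τ a ≡ true →
       ∃[ r ] (r ∈ P × a ∈ head r × BodyHolds τ r
               × All (λ x → x ≡ a ⊎ τ x ≡ false) (head r)))

Edge : ∀ {n} → Program n → Fin n → Fin n → Set
Edge P y x = ∃[ r ] (r ∈ P × x ∈ pos r × y ∈ head r)

data PathIn {n} (P : Program n) (L : Interp n) : Fin n → Fin n → Set where
  edge : ∀ {x y} → x ∈ᴹ L → y ∈ᴹ L → Edge P x y → PathIn P L x y
  step : ∀ {x z y} → x ∈ᴹ L → Edge P x z → PathIn P L z y → PathIn P L x y

Loop : ∀ {n} → Program n → Interp n → Set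
Loop P L = ∀ x y → x ∈ᴹ L → y ∈ᴹ L → PathIn P L x y

LA : ∀ {n} → Program n → Fin n → Set
LA P x = ∃[ L ] (x ∈ᴹ L × Loop P L)

-- Copy(P): τ on at(P), σ on the copy variables (σ x is the value of x̂;
-- only the entries for x ∈ LA(P) are ever used).

FHolds : ∀ {n} → Program n → Assignment n → Assignment n → Fin n → Set
FHolds P τ σ x = (LA P x × σ x ≡ true) ⊎ (¬ LA P x × τ x ≡ true)

CopySat : ∀ {n} → Program n → Assignment n → Assignment n → Set
CopySat P τ σ =
    (∀ x → LA P x → σ x ≡ true → τ x ≡ true)
  × (∀ r → r ∈ P → Any (LA P) (head r) →
       All (FHolds P τ σ) (pos r) → All (λ c → τ c ≡ false) (neg r) →
       Any (FHolds P τ σ) (head r))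

-- φ₂ under τ (at(P)), σ' (CV'), σ* (CV*)
Phi2Sat : ∀ {n} → Program n → Assignment n → Assignment n → Assignment n → Set
Phi2Sat P τ σ' σ* =
    CompSat P τ
  × CopySat P τ σ'
  × CopySat P τ σ*
  × (∀ x → LA P x → σ' x ≡ true → σ* x ≡ true)
  × (∃[ x ] (LA P x × σ' x ≡ false × σ* x ≡ true))

CountIs : ∀ {n} → (Interp n → Set) → ℕ → Set
CountIs {n} A k =
  Σ (List (Interp n)) λ xs → Unique xs × (∀ M → (M ∈ xs) ⇔ A M) × length xs ≡ k

-- #∃ CV' ∪ CV* φ₂ is the k with CountIs ProjPhi2 k
ProjPhi2 : ∀ {n} → Program n → Interp n → Set
ProjPhi2 {n} P M = ∃[ σ' ] ∃[ σ* ] Phi2Sat P (lookup M) σ' σ*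

CompNotAS : ∀ {n} → Program n → Interp n → Set
CompNotAS P M = CompSat P (lookup M) × ¬ AnswerSet P M

-- Let M ⊨ Comp(P) not be an answer set, witnessed by a model M' ⊊ M of P^M.  Then U = M ∖ M' is
-- a non-empty unfounded set: M ∖ U is still a model of P^M.  If U is not a loop, pick x, y ∈ U
-- such that y is not reachable from x inside U.  The atoms reachable from x inside U again form
-- an unfounded set; it is non-empty because the completion gives x a supporting rule whose
-- positive body must meet U, and it misses y.  Iterating on these smaller sets ends in an
-- unfounded loop L, and σ' = M ∖ L, σ* = M satisfy φ₂, an atom of L witnessing the last
-- conjunct.  Conversely, if σ', σ* satisfy φ₂, the atoms x with f(x) true under σ' form a model
-- of P^M strictly inside M.  So the two properties of M coincide, and both counts are the length
-- of the same filtered enumeration of all interpretations.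

module Submission where

open import Defs
open import Data.Nat using (ℕ; zero; suc; _<_)
open import Data.Nat.Induction using (<-wellFounded)
open import Induction.WellFounded using (Acc; acc)
open import Data.Product using (∃; ∃-syntax; _×_; _,_; proj₁; proj₂)
open import Data.Sum using (_⊎_; inj₁; inj₂)
open import Data.Empty using (⊥-elim)
open import Data.Bool using (true; false)
open import Data.Bool.Properties using (not-¬; ¬-not) renaming (_≟_ to _≟ᵇ_)
open import Data.Fin using (Fin; zero; suc)
open import Data.Fin.Properties using (any?; all?) renaming (_≟_ to _≟ᶠ_)
open import Data.Fin.Subset using (_─_; ⁅_⁆; ∣_∣)
open import Data.Fin.Subset.Properties using (p⊂q⇒∣p∣<∣q∣; anySubset?; x∈⁅x⁆; x≢y⇒x∉⁅y⁆)
open import Data.Vec using ([]; _∷_; lookup; tabulate)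
open import Data.Vec.Properties using (lookup∘tabulate; []=⇒lookup; lookup⇒[]=; ∷-injectiveʳ)
open import Data.List using (List; []; _∷_; _++_; map; filter; length)
open import Data.List.Relation.Unary.All as All using (All)
open import Data.List.Relation.Unary.All.Properties using (¬All⇒Any¬; All¬⇒¬Any)
open import Data.List.Relation.Unary.Any as Any using (Any)
open import Data.List.Relation.Unary.Any.Properties using (++⁺ˡ; ++⁺ʳ; ++⁻)
open import Data.List.Relation.Unary.AllPairs using ([]; _∷_)
open import Data.List.Relation.Unary.Unique.Propositional using (Unique)
import Data.List.Relation.Unary.Unique.Propositional.Properties as Unique
open import Data.List.Membership.Propositional using (_∈_; find; lose)
import Data.List.Membership.DecPropositional as DecMembership
open import Data.List.Membership.Propositional.Properties
  using (∈-map⁺; ∈-map⁻; ∈-++⁺ˡ; ∈-++⁺ʳ; ∈-filter⁺; ∈-filter⁻; ∈-map∘filter⁺; ∈-map∘filter⁻)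
open import Relation.Unary using (Decidable)
open import Relation.Nullary using (¬_; Dec; yes; no; does; contradiction)
open import Relation.Nullary.Decidable using (map′; _×-dec_; _⊎-dec_; _→-dec_; ¬?; dec-true; decidable-stable)
open import Relation.Binary.PropositionalEquality using (_≡_; _≢_; refl; sym; trans)
open import Function using (_∘_)
open import Function.Bundles using (_⇔_; mk⇔; Equivalence)
import Function.Properties.Equivalence as ⇔

private
  variable
    n : ℕ
    A : Set

_∈ᴹ?_ : (x : Fin n) (p : Interp n) → Dec (x ∈ᴹ p)
x ∈ᴹ? p = lookup p x ≟ᵇ true

_∉ᴹ?_ : (x : Fin n) (p : Interp n) → Dec (x ∉ᴹ p)
x ∉ᴹ? p = lookup p x ≟ᵇ false

_⊆ᴹ_ : Interp n → Interp n → Set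
p ⊆ᴹ q = ∀ x → x ∈ᴹ p → x ∈ᴹ q

⟦_⟧ : {Q : Fin n → Set} → Decidable Q → Interp n
⟦ Q? ⟧ = tabulate (does ∘ Q?)

∈⟦⟧⁺ : {Q : Fin n → Set} (Q? : Decidable Q) {x : Fin n} → Q x → x ∈ᴹ ⟦ Q? ⟧
∈⟦⟧⁺ Q? {x} q = trans (lookup∘tabulate (does ∘ Q?) x) (dec-true (Q? x) q)

∈⟦⟧⁻ : {Q : Fin n → Set} (Q? : Decidable Q) {x : Fin n} → x ∈ᴹ ⟦ Q? ⟧ → Q x
∈⟦⟧⁻ Q? {x} x∈ with Q? x | lookup∘tabulate (does ∘ Q?) x
... | yes q | _  = q
... | no _  | eq with () ← trans (sym eq) x∈

∈ᴹ-─⁺ : ∀ (p q : Interp n) x → x ∈ᴹ p → x ∉ᴹ q → x ∈ᴹ (p ─ q)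
∈ᴹ-─⁺ (_ ∷ _) (false ∷ _) zero    x∈p _ = x∈p
∈ᴹ-─⁺ (_ ∷ p) (_ ∷ q)     (suc x) = ∈ᴹ-─⁺ p q x

∈ᴹ-─⁻ : ∀ (p q : Interp n) x → x ∈ᴹ (p ─ q) → x ∈ᴹ p × x ∉ᴹ q
∈ᴹ-─⁻ (_ ∷ _) (false ∷ _) zero    x∈ = x∈ , refl
∈ᴹ-─⁻ (_ ∷ _) (true ∷ _)  zero    ()
∈ᴹ-─⁻ (_ ∷ p) (_ ∷ q)     (suc x) = ∈ᴹ-─⁻ p q x

∉ᴹ-─⁺ : ∀ (p q : Interp n) x → x ∈ᴹ q → x ∉ᴹ (p ─ q)
∉ᴹ-─⁺ (_ ∷ _) (true ∷ _) zero    _ = refl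
∉ᴹ-─⁺ (_ ∷ p) (_ ∷ q)    (suc x) = ∉ᴹ-─⁺ p q x

¬∈ᴹ-─⇒∈ᴹ : ∀ (p q : Interp n) x → ¬ x ∈ᴹ (p ─ q) → x ∈ᴹ p → x ∈ᴹ q
¬∈ᴹ-─⇒∈ᴹ p q x x∉ x∈p = decidable-stable (x ∈ᴹ? q) (λ x∉q → x∉ (∈ᴹ-─⁺ p q x x∈p (¬-not x∉q)))

∣∣-< : ∀ (p q : Interp n) x → p ⊆ᴹ q → x ∈ᴹ q → x ∉ᴹ p → ∣ p ∣ < ∣ q ∣
∣∣-< p q x p⊆q x∈q x∉p = p⊂q⇒∣p∣<∣q∣ {p = p}
  ( (λ {y} y∈p → lookup⇒[]= y q (p⊆q y ([]=⇒lookup {xs = p} y∈p)))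
  , x , lookup⇒[]= x q x∈q , λ x∈p → not-¬ x∉p ([]=⇒lookup {xs = p} x∈p))

∉ᴹ⁅⁆ : ∀ {x b : Fin n} → x ≢ b → x ∉ᴹ ⁅ b ⁆
∉ᴹ⁅⁆ {x = x} {b} x≢b = ¬-not (λ x∈ → x≢y⇒x∉⁅y⁆ x≢b (lookup⇒[]= x ⁅ b ⁆ x∈))

∈ᴹ⁅⁆ : ∀ (b : Fin n) → b ∈ᴹ ⁅ b ⁆
∈ᴹ⁅⁆ b = []=⇒lookup (x∈⁅x⁆ b)

allInterps : ∀ n → List (Interp n)
allInterps zero    = [] ∷ []
allInterps (suc n) = map (true ∷_) (allInterps n) ++ map (false ∷_) (allInterps n)

∈-allInterps : ∀ (M : Interp n) → M ∈ allInterps n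
∈-allInterps []          = Any.here refl
∈-allInterps (true ∷ M)  = ∈-++⁺ˡ (∈-map⁺ (true ∷_) (∈-allInterps M))
∈-allInterps {suc n} (false ∷ M) =
  ∈-++⁺ʳ (map (true ∷_) (allInterps n)) (∈-map⁺ (false ∷_) (∈-allInterps M))

allInterps-unique : ∀ n → Unique (allInterps n)
allInterps-unique zero    = All.[] ∷ []
allInterps-unique (suc n) = Unique.++⁺ (unique-∷ true) (unique-∷ false) disjoint
  where
  unique-∷ : ∀ b → Unique (map (b ∷_) (allInterps n))
  unique-∷ b = Unique.map⁺ ∷-injectiveʳ (allInterps-unique n)
  disjoint : ∀ {M} → ¬ (M ∈ map (true ∷_) (allInterps n) × M ∈ map (false ∷_) (allInterps n))
  disjoint (M∈t , M∈f) with ∈-map⁻ (true ∷_) M∈t | ∈-map⁻ (false ∷_) M∈f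
  ... | _ , _ , refl | _ , _ , ()

countIs-⇔ : {X Y : Interp n → Set} → Decidable X → (∀ M → X M ⇔ Y M) →
            ∃[ k ] (CountIs X k × CountIs Y k)
countIs-⇔ {n} {X} {Y} X? X⇔Y =
  length Ms , (Ms , unique , ∈Ms⇔X , refl)
            , (Ms , unique , (λ M → ⇔.trans (∈Ms⇔X M) (X⇔Y M)) , refl)
  where
  Ms = filter X? (allInterps n)
  unique = Unique.filter⁺ X? (allInterps-unique n)
  ∈Ms⇔X : ∀ M → M ∈ Ms ⇔ X M
  ∈Ms⇔X M = mk⇔ (proj₂ ∘ ∈-filter⁻ X? {xs = allInterps n}) (∈-filter⁺ X? (∈-allInterps M))

∃∈? : {Q : A → Set} → Decidable Q → (xs : List A) → Dec (∃[ x ] (x ∈ xs × Q x))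
∃∈? Q? xs = map′ find (λ (_ , x∈xs , q) → lose x∈xs q) (Any.any? Q? xs)

∀∈? : {Q : A → Set} → Decidable Q → (xs : List A) → Dec (∀ x → x ∈ xs → Q x)
∀∈? Q? xs = map′ (λ all _ x∈xs → All.lookup all x∈xs) (λ f → All.tabulate (f _)) (All.all? Q? xs)

module _ {n} (P : Program n) where
  open DecMembership (_≟ᶠ_ {n}) using (_∈?_)

  InSomeHead? : Decidable (InSomeHead P)
  InSomeHead? a = ∃∈? (λ r → a ∈? head r) P

  BodyHolds? : (τ : Assignment n) → Decidable (BodyHolds τ)
  BodyHolds? τ r = All.all? (λ b → τ b ≟ᵇ true) (pos r) ×-dec All.all? (λ c → τ c ≟ᵇ false) (neg r)

  CompSat? : Decidable (CompSat P)
  CompSat? τ =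
          all? (λ a → ¬? (InSomeHead? a) →-dec τ a ≟ᵇ false)
    ×-dec ∀∈? (λ r → BodyHolds? τ r →-dec Any.any? (λ x → τ x ≟ᵇ true) (head r)) P
    ×-dec all? (λ a → InSomeHead? a →-dec τ a ≟ᵇ true →-dec
                 ∃∈? (λ r → a ∈? head r ×-dec BodyHolds? τ r ×-dec
                           All.all? (λ x → x ≟ᶠ a ⊎-dec τ x ≟ᵇ false) (head r)) P)

  Edge? : ∀ y x → Dec (Edge P y x)
  Edge? y x = ∃∈? (λ r → x ∈? pos r ×-dec y ∈? head r) P

_⊨r?_ : (M : Interp n) → Decidable (M ⊨r_)
M ⊨r? r = Any.any? (_∈ᴹ? M) (head r ++ neg r) ⊎-dec Any.any? (_∉ᴹ? M) (pos r)

_⊨?_ : (M : Interp n) → Decidable (M ⊨_)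
M ⊨? P = All.all? (M ⊨r?_) P

_⊊?_ : (M' M : Interp n) → Dec (M' ⊊ M)
M' ⊊? M = all? (λ x → x ∈ᴹ? M' →-dec x ∈ᴹ? M) ×-dec any? (λ x → x ∈ᴹ? M ×-dec x ∉ᴹ? M')

AnswerSet? : (P : Program n) → Decidable (AnswerSet P)
AnswerSet? P M = M ⊨? P ×-dec ¬? (anySubset? (λ M' → M' ⊊? M ×-dec M' ⊨? reduct P M))

CompNotAS? : (P : Program n) → Decidable (CompNotAS P)
CompNotAS? P M = CompSat? P (lookup M) ×-dec ¬? (AnswerSet? P M)

module _ {n} (P : Program n) where

  data Walk (L : Interp n) : Fin n → Fin n → Set where
    []   : ∀ {y} → Walk L y y
    step : ∀ {a b y} → Edge P a b → b ∈ᴹ L → Walk L b y → Walk L a y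

  walk-mono : ∀ {L L' a y} → L ⊆ᴹ L' → Walk L a y → Walk L' a y
  walk-mono L⊆L' []              = []
  walk-mono L⊆L' (step e b∈L w) = step e (L⊆L' _ b∈L) (walk-mono L⊆L' w)

  walk-split : ∀ {L a y} z → Walk L a y → Walk (L ─ ⁅ z ⁆) a y ⊎ Walk (L ─ ⁅ z ⁆) z y
  walk-split z [] = inj₁ []
  walk-split {L} z (step {b = b} e b∈L w) with walk-split z w | b ≟ᶠ z
  ... | inj₂ w' | _        = inj₂ w'
  ... | inj₁ w' | yes refl = inj₂ w'
  ... | inj₁ w' | no b≢z   = inj₁ (step e (∈ᴹ-─⁺ L ⁅ z ⁆ b b∈L (∉ᴹ⁅⁆ b≢z)) w')

  -- A walk from b may avoid re-entering b: cut it at its last visit to b.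
  walk-avoid : ∀ {L b y} → Walk L b y → Walk (L ─ ⁅ b ⁆) b y
  walk-avoid {b = b} w with walk-split b w
  ... | inj₁ w' = w'
  ... | inj₂ w' = w'

  walk? : ∀ L → Acc _<_ ∣ L ∣ → ∀ a y → Dec (Walk L a y)
  walk? L (acc rec) a y with a ≟ᶠ y
  ... | yes refl = yes []
  ... | no a≢y = map′ fromStep toStep (any? firstStep?)
    where
    L-_ : Fin n → Interp n
    L- b = L ─ ⁅ b ⁆
    L-⊆L : ∀ b → (L- b) ⊆ᴹ L
    L-⊆L b x x∈ = proj₁ (∈ᴹ-─⁻ L ⁅ b ⁆ x x∈)
    firstStep? : ∀ b → Dec (b ∈ᴹ L × Edge P a b × Walk (L- b) b y)
    firstStep? b with b ∈ᴹ? L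
    ... | no b∉L = no (b∉L ∘ proj₁)
    ... | yes b∈L = map′ (b∈L ,_) proj₂ (Edge? P a b ×-dec walk? (L- b) (rec smaller) b y)
      where
      smaller : ∣ L- b ∣ < ∣ L ∣
      smaller = ∣∣-< (L- b) L b (L-⊆L b) b∈L (∉ᴹ-─⁺ L ⁅ b ⁆ b (∈ᴹ⁅⁆ b))
    fromStep : ∃[ b ] (b ∈ᴹ L × Edge P a b × Walk (L- b) b y) → Walk L a y
    fromStep (b , b∈L , e , w) = step e b∈L (walk-mono (L-⊆L b) w)
    toStep : Walk L a y → ∃[ b ] (b ∈ᴹ L × Edge P a b × Walk (L- b) b y)
    toStep []              = contradiction refl a≢y
    toStep (step e b∈L w) = _ , b∈L , e , walk-avoid w

  source∈ : ∀ {L x y} → PathIn P L x y → x ∈ᴹ L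
  source∈ (edge x∈L _ _) = x∈L
  source∈ (step x∈L _ _) = x∈L

  target∈ : ∀ {L x y} → PathIn P L x y → y ∈ᴹ L
  target∈ (edge _ y∈L _) = y∈L
  target∈ (step _ _ p)   = target∈ p

  pathIn-snoc : ∀ {L x y z} → PathIn P L x y → Edge P y z → z ∈ᴹ L → PathIn P L x z
  pathIn-snoc (edge x∈L y∈L e) e' z∈L = step x∈L e (edge y∈L z∈L e')
  pathIn-snoc (step x∈L e p)   e' z∈L = step x∈L e (pathIn-snoc p e' z∈L)

  pathIn⇒walk : ∀ {L x y} → PathIn P L x y → Walk L x y
  pathIn⇒walk (edge _ y∈L e) = step e y∈L []
  pathIn⇒walk (step _ e p)   = step e (source∈ p) (pathIn⇒walk p)

  walk⇒pathIn : ∀ {L x z y} → x ∈ᴹ L → Edge P x z → z ∈ᴹ L → Walk L z y → PathIn P L x y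
  walk⇒pathIn x∈L e z∈L []              = edge x∈L z∈L e
  walk⇒pathIn x∈L e z∈L (step e' b∈L w) = step x∈L e (walk⇒pathIn z∈L e' b∈L w)

  PathIn? : ∀ L x y → Dec (PathIn P L x y)
  PathIn? L x y = map′ from to
    (x ∈ᴹ? L ×-dec any? (λ z → Edge? P x z ×-dec z ∈ᴹ? L ×-dec walk? L (<-wellFounded _) z y))
    where
    from : x ∈ᴹ L × ∃[ z ] (Edge P x z × z ∈ᴹ L × Walk L z y) → PathIn P L x y
    from (x∈L , z , e , z∈L , w) = walk⇒pathIn x∈L e z∈L w
    to : PathIn P L x y → x ∈ᴹ L × ∃[ z ] (Edge P x z × z ∈ᴹ L × Walk L z y)
    to (edge x∈L y∈L e) = x∈L , y , e , y∈L , []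
    to (step x∈L e p)   = x∈L , _ , e , source∈ p , pathIn⇒walk p

  loop-or-gap : ∀ L → Loop P L ⊎ ∃[ x ] ∃[ y ] (x ∈ᴹ L × y ∈ᴹ L × ¬ PathIn P L x y)
  loop-or-gap L with any? (λ x → any? (λ y → x ∈ᴹ? L ×-dec y ∈ᴹ? L ×-dec ¬? (PathIn? L x y)))
  ... | yes gap = inj₂ gap
  ... | no ¬gap = inj₁ λ x y x∈L y∈L →
    decidable-stable (PathIn? L x y) (λ ¬p → ¬gap (x , y , x∈L , y∈L , ¬p))

  Loop? : Decidable (Loop P)
  Loop? L with loop-or-gap L
  ... | inj₁ loop = yes loop
  ... | inj₂ (x , y , x∈L , y∈L , ¬p) = no λ loop → ¬p (loop x y x∈L y∈L)

  LA? : Decidable (LA P)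
  LA? x = anySubset? (λ L → x ∈ᴹ? L ×-dec Loop? L)

  reachable : Interp n → Fin n → Interp n
  reachable U x = ⟦ PathIn? U x ⟧

  reachable-⊆ : ∀ U x → reachable U x ⊆ᴹ U
  reachable-⊆ U x z z∈ = target∈ (∈⟦⟧⁻ (PathIn? U x) z∈)

-- Unfounded sets

module _ {n} (P : Program n) (M : Interp n) where

  ModelOfReduct : Interp n → Set
  ModelOfReduct N = ∀ r → r ∈ P → All (_∉ᴹ M) (neg r) → All (_∈ᴹ N) (pos r) → Any (_∈ᴹ N) (head r)

  ⊨reduct⇔ : ∀ N → N ⊨ reduct P M ⇔ ModelOfReduct N
  ⊨reduct⇔ N = mk⇔ to from
    where
    keep? = λ (r : Rule n) → All.all? (λ c → lookup M c ≟ᵇ false) (neg r)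
    reduce = λ (r : Rule n) → head r ⇐ pos r ∣ []
    to : N ⊨ reduct P M → ModelOfReduct N
    to N⊨ r r∈P neg∉M pos∈N
      with All.lookup N⊨ (∈-map∘filter⁺ reduce keep? (r , r∈P , refl , neg∉M))
    ... | inj₂ pos∉N = contradiction pos∉N (All¬⇒¬Any (All.map not-¬ pos∈N))
    ... | inj₁ head∈N with ++⁻ (head r) head∈N
    ...   | inj₁ h = h
    ...   | inj₂ ()
    from : ModelOfReduct N → N ⊨ reduct P M
    from model = All.tabulate λ r'∈ → satisfied (∈-map∘filter⁻ reduce keep? {xs = P} r'∈)
      where
      satisfied : ∀ {r'} → ∃[ r ] (r ∈ P × r' ≡ reduce r × All (_∉ᴹ M) (neg r)) → N ⊨r r'
      satisfied (r , r∈P , refl , neg∉M) with All.all? (_∈ᴹ? N) (pos r)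
      ... | yes pos∈N = inj₁ (++⁺ˡ (model r r∈P neg∉M pos∈N))
      ... | no ¬pos∈N = inj₂ (Any.map ¬-not (¬All⇒Any¬ (_∈ᴹ? N) (pos r) ¬pos∈N))

  Unfounded : Interp n → Set
  Unfounded U = U ⊆ᴹ M × ModelOfReduct (M ─ U)

  ¬answerSet⇒unfounded : M ⊨ P → ¬ AnswerSet P M → ∃[ U ] (Unfounded U × ∃ (_∈ᴹ U))
  ¬answerSet⇒unfounded M⊨P ¬as with anySubset? (λ M' → M' ⊊? M ×-dec M' ⊨? reduct P M)
  ... | no ¬smaller = contradiction (M⊨P , ¬smaller) ¬as
  ... | yes (M' , (M'⊆M , u , u∈M , u∉M') , M'⊨) =
        M ─ M' , (U⊆M , model) , u , ∈ᴹ-─⁺ M M' u u∈M u∉M'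
    where
    U⊆M : (M ─ M') ⊆ᴹ M
    U⊆M x x∈ = proj₁ (∈ᴹ-─⁻ M M' x x∈)
    ∈M─U⇒∈M' : ∀ {x} → x ∈ᴹ (M ─ (M ─ M')) → x ∈ᴹ M'
    ∈M─U⇒∈M' {x} x∈ with ∈ᴹ-─⁻ M (M ─ M') x x∈
    ... | x∈M , x∉U = ¬∈ᴹ-─⇒∈ᴹ M M' x (not-¬ x∉U) x∈M
    ∈M'⇒∈M─U : ∀ {x} → x ∈ᴹ M' → x ∈ᴹ (M ─ (M ─ M'))
    ∈M'⇒∈M─U {x} x∈M' = ∈ᴹ-─⁺ M (M ─ M') x (M'⊆M x x∈M') (∉ᴹ-─⁺ M M' x x∈M')
    model : ModelOfReduct (M ─ (M ─ M'))
    model r r∈P neg∉M pos∈ =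
      Any.map ∈M'⇒∈M─U (Equivalence.to (⊨reduct⇔ M') M'⊨ r r∈P neg∉M (All.map ∈M─U⇒∈M' pos∈))

  module _ (comp : CompSat P (lookup M)) where

    comp⇒ModelOfReduct : ModelOfReduct M
    comp⇒ModelOfReduct r r∈P neg∉M pos∈M = proj₁ (proj₂ comp) r r∈P (pos∈M , neg∉M)

    comp⇒⊨ : M ⊨ P
    comp⇒⊨ = All.tabulate λ {r} r∈P → satisfied r r∈P
      where
      satisfied : ∀ r → r ∈ P → M ⊨r r
      satisfied r r∈P with All.all? (_∈ᴹ? M) (pos r) | All.all? (_∉ᴹ? M) (neg r)
      ... | no ¬pos∈M | _ = inj₂ (Any.map ¬-not (¬All⇒Any¬ (_∈ᴹ? M) (pos r) ¬pos∈M))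
      ... | yes _ | no ¬neg∉M =
            inj₁ (++⁺ʳ (head r) (Any.map ¬-not (¬All⇒Any¬ (_∉ᴹ? M) (neg r) ¬neg∉M)))
      ... | yes pos∈M | yes neg∉M = inj₁ (++⁺ˡ (comp⇒ModelOfReduct r r∈P neg∉M pos∈M))

    reachable-nonempty : ∀ {U x} → Unfounded U → x ∈ᴹ U → ∃ (_∈ᴹ reachable P U x)
    reachable-nonempty {U} {x} (U⊆M , model) x∈U with InSomeHead? P x
    ... | no ¬inHead = contradiction (U⊆M x x∈U) (not-¬ (proj₁ comp x ¬inHead))
    ... | yes inHead with proj₂ (proj₂ comp) x inHead (U⊆M x x∈U)
    ... | r , r∈P , x∈head , (pos∈M , neg∉M) , othersFalse with All.all? (_∈ᴹ? (M ─ U)) (pos r)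
    ...   | yes pos∈M─U = ⊥-elim (unsupportedHead (find (model r r∈P neg∉M pos∈M─U)))
      where
      unsupportedHead : ¬ (∃[ h ] (h ∈ head r × h ∈ᴹ (M ─ U)))
      unsupportedHead (h , h∈head , h∈M─U) with All.lookup othersFalse h∈head | ∈ᴹ-─⁻ M U h h∈M─U
      ... | inj₁ refl | _ , h∉U = not-¬ h∉U x∈U
      ... | inj₂ h∉M  | h∈M , _ = not-¬ h∉M h∈M
    ...   | no ¬pos∈M─U with find (¬All⇒Any¬ (_∈ᴹ? (M ─ U)) (pos r) ¬pos∈M─U)
    ...     | b , b∈pos , b∉M─U =
              b , ∈⟦⟧⁺ (PathIn? P U x) (edge x∈U b∈U (r , r∈P , b∈pos , x∈head))
      where
      b∈U : b ∈ᴹ U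
      b∈U = ¬∈ᴹ-─⇒∈ᴹ M U b b∉M─U (All.lookup pos∈M b∈pos)

    reachable-unfounded : ∀ {U x} → Unfounded U → Unfounded (reachable P U x)
    reachable-unfounded {U} {x} (U⊆M , model) = R⊆M , modelR
      where
      R = reachable P U x
      R⊆M : R ⊆ᴹ M
      R⊆M z z∈R = U⊆M z (reachable-⊆ P U x z z∈R)
      inM : ∀ {z} → z ∈ᴹ (M ─ R) → z ∈ᴹ M
      inM {z} z∈ = proj₁ (∈ᴹ-─⁻ M R z z∈)
      M─U⊆M─R : ∀ {z} → z ∈ᴹ (M ─ U) → z ∈ᴹ (M ─ R)
      M─U⊆M─R {z} z∈ with ∈ᴹ-─⁻ M U z z∈
      ... | z∈M , z∉U = ∈ᴹ-─⁺ M R z z∈M (¬-not (λ z∈R → not-¬ z∉U (reachable-⊆ P U x z z∈R)))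
      modelR : ModelOfReduct (M ─ R)
      modelR r r∈P neg∉M pos∈M─R with find (comp⇒ModelOfReduct r r∈P neg∉M (All.map inM pos∈M─R))
      ... | h , h∈head , h∈M with h ∈ᴹ? R
      ...   | no h∉R = lose h∈head (∈ᴹ-─⁺ M R h h∈M (¬-not h∉R))
      ...   | yes h∈R with All.all? (_∈ᴹ? (M ─ U)) (pos r)
      ...     | yes pos∈M─U = Any.map M─U⊆M─R (model r r∈P neg∉M pos∈M─U)
      ...     | no ¬pos∈M─U with find (¬All⇒Any¬ (_∈ᴹ? (M ─ U)) (pos r) ¬pos∈M─U)
      ...       | b , b∈pos , b∉M─U = contradiction b∈R (not-¬ (proj₂ (∈ᴹ-─⁻ M R b b∈M─R)))
        where
        b∈M─R = All.lookup pos∈M─R b∈pos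
        b∈U = ¬∈ᴹ-─⇒∈ᴹ M U b b∉M─U (inM b∈M─R)
        b∈R : b ∈ᴹ R
        b∈R = ∈⟦⟧⁺ (PathIn? P U x)
                (pathIn-snoc P (∈⟦⟧⁻ (PathIn? P U x) h∈R) (r , r∈P , b∈pos , h∈head) b∈U)

    unfounded-loop : ∀ U → Acc _<_ ∣ U ∣ → Unfounded U → ∃ (_∈ᴹ U) →
                     ∃[ L ] (Unfounded L × ∃ (_∈ᴹ L) × Loop P L)
    unfounded-loop U (acc rec) unf nonempty with loop-or-gap P U
    ... | inj₁ loop = U , unf , nonempty , loop
    ... | inj₂ (x , y , x∈U , y∈U , ¬path) =
          unfounded-loop R (rec (∣∣-< R U y (reachable-⊆ P U x) y∈U y∉R))
            (reachable-unfounded unf) (reachable-nonempty unf x∈U)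
      where
      R = reachable P U x
      y∉R : y ∉ᴹ R
      y∉R = ¬-not (¬path ∘ ∈⟦⟧⁻ (PathIn? P U x))

  -- The copy construction

  copySat : ∀ N → N ⊆ᴹ M → (∀ x → ¬ LA P x → x ∈ᴹ M → x ∈ᴹ N) → ModelOfReduct N →
            CopySat P (lookup M) (lookup N)
  copySat N N⊆M agree model =
    (λ x _ → N⊆M x) ,
    λ r r∈P _ pos-copied neg∉M → Any.map copied (model r r∈P neg∉M (All.map inN pos-copied))
    where
    inN : ∀ {x} → FHolds P (lookup M) (lookup N) x → x ∈ᴹ N
    inN     (inj₁ (_ , x∈N))   = x∈N
    inN {x} (inj₂ (¬la , x∈M)) = agree x ¬la x∈M
    copied : ∀ {x} → x ∈ᴹ N → FHolds P (lookup M) (lookup N) x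
    copied {x} x∈N with LA? P x
    ... | yes la = inj₁ (la , x∈N)
    ... | no ¬la = inj₂ (¬la , N⊆M x x∈N)

  compNotAS⇒projPhi2 : CompNotAS P M → ProjPhi2 P M
  compNotAS⇒projPhi2 (comp , ¬as) with ¬answerSet⇒unfounded (comp⇒⊨ comp) ¬as
  ... | U , unf , nonempty with unfounded-loop comp U (<-wellFounded _) unf nonempty
  ... | L , (L⊆M , model) , (u , u∈L) , loop =
        lookup (M ─ L) , lookup M , comp
      , copySat (M ─ L) M─L⊆M agree model
      , copySat M (λ _ x∈M → x∈M) (λ _ _ x∈M → x∈M) (comp⇒ModelOfReduct comp)
      , (λ x _ → M─L⊆M x)
      , u , (L , u∈L , loop) , ∉ᴹ-─⁺ M L u u∈L , L⊆M u u∈L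
    where
    M─L⊆M : (M ─ L) ⊆ᴹ M
    M─L⊆M x x∈ = proj₁ (∈ᴹ-─⁻ M L x x∈)
    agree : ∀ x → ¬ LA P x → x ∈ᴹ M → x ∈ᴹ (M ─ L)
    agree x ¬la x∈M = ∈ᴹ-─⁺ M L x x∈M (¬-not (λ x∈L → ¬la (L , x∈L , loop)))

  projPhi2⇒compNotAS : ProjPhi2 P M → CompNotAS P M
  projPhi2⇒compNotAS
    (σ' , σ* , comp , (copy'⊆M , copy'-closed) , (copy*⊆M , _) , _ , x , la , σ'x , σ*x) =
    comp , λ (_ , minimal) →
      minimal (N , (N⊆M , x , copy*⊆M x la σ*x , x∉N) , Equivalence.from (⊨reduct⇔ N) model)
    where
    FHolds? : Decidable (FHolds P (lookup M) σ')
    FHolds? y = (LA? P y ×-dec σ' y ≟ᵇ true) ⊎-dec (¬? (LA? P y) ×-dec lookup M y ≟ᵇ true)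
    N = ⟦ FHolds? ⟧
    N⊆M : N ⊆ᴹ M
    N⊆M y y∈N with ∈⟦⟧⁻ FHolds? y∈N
    ... | inj₁ (la , σ'y) = copy'⊆M y la σ'y
    ... | inj₂ (_ , y∈M)  = y∈M
    x∉N : x ∉ᴹ N
    x∉N with x ∈ᴹ? N
    ... | no x∉ = ¬-not x∉
    ... | yes x∈N with ∈⟦⟧⁻ FHolds? x∈N
    ...   | inj₁ (_ , σ'x≡true) = contradiction σ'x≡true (not-¬ σ'x)
    ...   | inj₂ (¬la , _)       = contradiction la ¬la
    model : ModelOfReduct N
    model r r∈P neg∉M pos∈N with Any.any? (LA? P) (head r)
    ... | yes someLA =
          Any.map (∈⟦⟧⁺ FHolds?) (copy'-closed r r∈P someLA (All.map (∈⟦⟧⁻ FHolds?) pos∈N) neg∉M)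
    ... | no noLA with find (comp⇒ModelOfReduct comp r r∈P neg∉M (All.map (N⊆M _) pos∈N))
    ...   | h , h∈head , h∈M = lose h∈head (∈⟦⟧⁺ FHolds? (inj₂ (noLA ∘ lose h∈head , h∈M)))

lemma4 : ∀ (n : ℕ) (P : Program n) →
         ∃[ k ] (CountIs (CompNotAS P) k × CountIs (ProjPhi2 P) k)
lemma4 n P = countIs-⇔ (CompNotAS? P) λ M → mk⇔ (compNotAS⇒projPhi2 P M) (projPhi2⇒compNotAS P M)
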